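{- Enf bisimilarity $\simeq_{enf}$ validates each of the following equivalences (that is, every pair of terms related by the closure under all contexts of the axiom is $\simeq_{enf}$-related): left identity $(\lambda x.x)t\equiv t$; associativity $(\lambda x.t)((\lambda y.u)s)\equiv(\lambda y.(\lambda x.t)u)s$ if $y\notin fv(t)$; left decomposition $tu\equiv(\lambda x.xu)t$ if $x\notin fv(u)$; right decomposition $vt\equiv(\lambda x.vx)t$ if $v$ is a value and $x\notin fv(v)$; left application $(\lambda x.t)us\equiv(\lambda x.ts)u$ if $x\notin fv(s)$; value right application $v((\lambda y.u)s)\equiv(\lambda y.vu)s$ if $v$ is a value and $y\notin fv(v)$. It does not validate (i.e. each has instances whose two sides are not $\simeq_{enf}$-related): $\eta_v$-equivalence $y\equiv\lambda x.yx$ ($y$ a variable); unrestricted right application $t((\lambda y.u)s)\equiv(\lambda y.tu)s$ if $y\notin fv(t)$; commutativity $(\lambda y.(\lambda x.t)u)s\equiv(\lambda x.(\lambda y.t)s)u$ if $x\notin fv(s)$, $y\notin fv(u)$; CbN duplication $(\lambda x.yxx)u\equiv yuu$.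
   Context: Plotkin terms $t::=v\mid tu$, values $v::=x\mid\lambda x.t$; contexts $C::=\langle\cdot\rangle\mid tC\mid Ct\mid\lambda x.C$. Root rule $(\lambda x.t)v\mapsto t\{x:=v\}$ ($v$ value). Left contexts $L::=\langle\cdot\rangle\mid vL\mid Lt$; left reduction $\to_l$: closure under left contexts. $t\Downarrow_ln$: $t\to_l^*n$ with $n$ $\to_l$-normal. Enf simulation: $R$ such that whenever $tRt'$ one of: $t$ has no $\to_l$-normal form; $t\Downarrow_lx$ and $t'\Downarrow_lx$; $t\Downarrow_l\lambda x.t_1$, $t'\Downarrow_l\lambda x.t_1'$, $t_1Rt_1'$; $t\Downarrow_lL\langle xv\rangle$, $t'\Downarrow_lL'\langle xv'\rangle$ with $vRv'$ and $L\langle z\rangle RL'\langle z\rangle$, $z$ not free in $L,L'$. Enf bisimilarity: $t\simeq_{enf}u$ iff there is $R$ with $tRu$ such that $R$ and its converse are enf simulations. -}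

module Defs where

open import Data.Nat using (ℕ; zero; suc)
open import Data.Empty using (⊥)
open import Data.Sum using (_⊎_)
open import Data.Product using (Σ; _×_; ∃; ∃-syntax)
open import Relation.Nullary using (¬_)
open import Relation.Binary.PropositionalEquality using (_≡_)
open import Relation.Binary.Construct.Closure.ReflexiveTransitive using (Star)

-- Plotkin's untyped λ-terms, de Bruijn indices.
-- A free variable with index n (at top level) is the variable "n".

data Tm : Set where
  var : ℕ → Tm
  lam : Tm → Tm
  app : Tm → Tm → Tm

data Value : Tm → Set where
  var : ∀ x → Value (var x)
  lam : ∀ t → Value (lam t)

ext : (ℕ → ℕ) → ℕ → ℕ
ext ρ zero    = zero
ext ρ (suc n) = suc (ρ n)

rename : (ℕ → ℕ) → Tm → Tm
rename ρ (var x)   = var (ρ x)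
rename ρ (lam t)   = lam (rename (ext ρ) t)
rename ρ (app t u) = app (rename ρ t) (rename ρ u)

exts : (ℕ → Tm) → ℕ → Tm
exts σ zero    = var zero
exts σ (suc n) = rename suc (σ n)

subst : (ℕ → Tm) → Tm → Tm
subst σ (var x)   = σ x
subst σ (lam t)   = lam (subst (exts σ) t)
subst σ (app t u) = app (subst σ t) (subst σ u)

single : Tm → ℕ → Tm
single v zero    = v
single v (suc n) = var n

_[_] : Tm → Tm → Tm
t [ v ] = subst (single v) t

wk : Tm → Tm
wk = rename suc

-- weakening under one binder (index 0 stays, a fresh variable at index 1)
wk1 : Tm → Tm
wk1 = rename (ext suc)

swap01 : ℕ → ℕ
swap01 zero          = suc zero
swap01 (suc zero)    = zero
swap01 (suc (suc n)) = suc (suc n)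

Occurs : ℕ → Tm → Set
Occurs x (var y)   = x ≡ y
Occurs x (lam t)   = Occurs (suc x) t
Occurs x (app t u) = Occurs x t ⊎ Occurs x u

data Ctx : Set where
  hole : Ctx
  appR : Tm → Ctx → Ctx
  appL : Ctx → Tm → Ctx
  lamC : Ctx → Ctx

plug : Ctx → Tm → Tm
plug hole       s = s
plug (appR t C) s = app t (plug C s)
plug (appL C t) s = app (plug C s) t
plug (lamC C)   s = lam (plug C s)

data LCtx : Set where
  hole : LCtx
  vapp : (v : Tm) → Value v → LCtx → LCtx
  lapp : LCtx → Tm → LCtx

plugL : LCtx → Tm → Tm
plugL hole         s = s
plugL (vapp v _ L) s = app v (plugL L s)
plugL (lapp L t)   s = app (plugL L s) t

OccursL : ℕ → LCtx → Set
OccursL x hole         = ⊥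
OccursL x (vapp v _ L) = Occurs x v ⊎ OccursL x L
OccursL x (lapp L t)   = OccursL x L ⊎ Occurs x t

data _↦_ : Tm → Tm → Set where
  βv : ∀ t v → Value v → app (lam t) v ↦ (t [ v ])

data _→l_ : Tm → Tm → Set where
  ctx : ∀ (L : LCtx) {t u} → t ↦ u → plugL L t →l plugL L u

_→l*_ : Tm → Tm → Set
_→l*_ = Star _→l_

Normal : Tm → Set
Normal t = ¬ (∃[ u ] (t →l u))

_⇓_ : Tm → Tm → Set
t ⇓ n = (t →l* n) × Normal n

-- Enf simulations and enf bisimilarity.
-- Stated in the (classically equivalent) form "whenever t ⇓ n, one of
-- the three normal-form clauses holds".

SimClause : (Tm → Tm → Set) → Tm → Tm → Set
SimClause R n t′ =
    (∃[ x ] (n ≡ var x × t′ ⇓ var x))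
  ⊎ (∃[ t₁ ] (n ≡ lam t₁ × ∃[ t₁′ ] (t′ ⇓ lam t₁′ × R t₁ t₁′)))
  ⊎ (Σ LCtx λ L → ∃[ x ] ∃[ v ] (Value v × n ≡ plugL L (app (var x) v) ×
       Σ LCtx λ L′ → ∃[ v′ ] (Value v′ × t′ ⇓ plugL L′ (app (var x) v′) ×
         R v v′ ×
         ∃[ z ] (¬ OccursL z L × ¬ OccursL z L′ ×
                 R (plugL L (var z)) (plugL L′ (var z))))))

EnfSim : (Tm → Tm → Set) → Set
EnfSim R = ∀ t t′ → R t t′ → ∀ n → t ⇓ n → SimClause R n t′

Converse : (Tm → Tm → Set) → Tm → Tm → Set
Converse R t u = R u t

_≃enf_ : Tm → Tm → Set₁
t ≃enf u = Σ (Tm → Tm → Set) λ R → R t u × EnfSim R × EnfSim (Converse R)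

-- Axioms (de Bruijn versions; side conditions "x ∉ fv(…)" are expressed
-- by weakening the relevant subterm).

-- (λx.x)t ≡ t
data LeftId : Tm → Tm → Set where
  ax : ∀ t → LeftId (app (lam (var zero)) t) t

-- (λx.t)((λy.u)s) ≡ (λy.(λx.t)u)s,  y ∉ fv(t)
data Assoc : Tm → Tm → Set where
  ax : ∀ t u s → Assoc (app (lam t) (app (lam u) s))
                       (app (lam (app (lam (wk1 t)) u)) s)

-- tu ≡ (λx.xu)t,  x ∉ fv(u)
data LeftDec : Tm → Tm → Set where
  ax : ∀ t u → LeftDec (app t u) (app (lam (app (var zero) (wk u))) t)

-- vt ≡ (λx.vx)t,  v value, x ∉ fv(v)
data RightDec : Tm → Tm → Set where
  ax : ∀ v t → Value v → RightDec (app v t) (app (lam (app (wk v) (var zero))) t)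

-- (λx.t)us ≡ (λx.ts)u,  x ∉ fv(s)
data LeftApp : Tm → Tm → Set where
  ax : ∀ t u s → LeftApp (app (app (lam t) u) s) (app (lam (app t (wk s))) u)

-- v((λy.u)s) ≡ (λy.vu)s,  v value, y ∉ fv(v)
data ValRightApp : Tm → Tm → Set where
  ax : ∀ v u s → Value v →
       ValRightApp (app v (app (lam u) s)) (app (lam (app (wk v) u)) s)

-- y ≡ λx.yx,  y a variable
data EtaV : Tm → Tm → Set where
  ax : ∀ y → EtaV (var y) (lam (app (var (suc y)) (var zero)))

-- t((λy.u)s) ≡ (λy.tu)s,  y ∉ fv(t)
data RightApp : Tm → Tm → Set where
  ax : ∀ t u s → RightApp (app t (app (lam u) s)) (app (lam (app (wk t) u)) s)

-- (λy.(λx.t)u)s ≡ (λx.(λy.t)s)u,  x ∉ fv(s), y ∉ fv(u)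
-- (t is written in scope "… , y , x"; on the right the two binders are
--  exchanged, hence the renaming swap01)
data Comm : Tm → Tm → Set where
  ax : ∀ t u s → Comm (app (lam (app (lam t) (wk u))) s)
                      (app (lam (app (lam (rename swap01 t)) (wk s))) u)

-- (λx.yxx)u ≡ yuu,  y a variable
data CbNDup : Tm → Tm → Set where
  ax : ∀ y u → CbNDup (app (lam (app (app (var (suc y)) (var zero)) (var zero))) u)
                      (app (app (var y) u) u)

data CtxClosure (A : Tm → Tm → Set) : Tm → Tm → Set where
  cl : ∀ (C : Ctx) {l r} → A l r → CtxClosure A (plug C l) (plug C r)

Validates : (Tm → Tm → Set) → Set₁
Validates A = ∀ t u → CtxClosure A t u → t ≃enf u

NotValidates : (Tm → Tm → Set) → Set₁
NotValidates A = ∃[ t ] ∃[ u ] (CtxClosure A t u × ¬ (t ≃enf u))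

-- Let t ~ t′ when t′ arises from t by rewriting, in parallel and in either direction, instances
-- of the six valid axioms. This relation is symmetric and closed under substitution of related
-- values, hence stable under β. It is an enf simulation: a left step of one side is matched by
-- finitely many left steps of the other (the extra steps fire the administrative redexes that the
-- axioms introduce), and normal forms related by ~ have the same shape: the same variable,
-- λ-abstractions with related bodies, or stuck terms L⟨x v⟩, L′⟨x v′⟩ with v ~ v′ and L ~ L′.
-- Each invalid equivalence has an instance with a normal left side whose right side either
-- diverges (right application and commutativity, via Ω), is a λ facing a variable (η_v), or can
-- only be matched by identifying a fresh variable with a free one (CbN duplication).

module Submission where

open import Defs
open import Data.Nat using (ℕ; zero; suc; _+_; _<_)
open import Data.Nat.Properties using (m≤m+n; m≤n+m; ≤-trans; ≤⇒≯; n≤1+n; ≤-refl)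
open import Data.Empty using (⊥-elim)
open import Data.Sum using (_⊎_; inj₁; inj₂)
open import Data.Product using (Σ; _×_; _,_; proj₁; proj₂; ∃-syntax)
open import Function using (_∘_)
open import Relation.Nullary using (¬_)
open import Relation.Binary.PropositionalEquality as ≡ using (_≡_; _≢_; refl; sym; trans; cong; cong₂; subst₂)
open import Relation.Binary.Construct.Closure.ReflexiveTransitive using (ε; _◅_; _◅◅_; gmap)

-- Renaming and substitution

ext-cong : ∀ {ρ ρ′ : ℕ → ℕ} → (∀ x → ρ x ≡ ρ′ x) → ∀ x → ext ρ x ≡ ext ρ′ x
ext-cong h zero    = refl
ext-cong h (suc x) = cong suc (h x)

rename-cong : ∀ {ρ ρ′ : ℕ → ℕ} → (∀ x → ρ x ≡ ρ′ x) → ∀ t → rename ρ t ≡ rename ρ′ t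
rename-cong h (var x)   = cong var (h x)
rename-cong h (lam t)   = cong lam (rename-cong (ext-cong h) t)
rename-cong h (app t u) = cong₂ app (rename-cong h t) (rename-cong h u)

ext-∘ : ∀ (ρ ρ′ : ℕ → ℕ) x → ext ρ (ext ρ′ x) ≡ ext (ρ ∘ ρ′) x
ext-∘ ρ ρ′ zero    = refl
ext-∘ ρ ρ′ (suc x) = refl

rename-∘ : ∀ (ρ ρ′ : ℕ → ℕ) t → rename ρ (rename ρ′ t) ≡ rename (ρ ∘ ρ′) t
rename-∘ ρ ρ′ (var x)   = refl
rename-∘ ρ ρ′ (lam t)   =
  cong lam (trans (rename-∘ (ext ρ) (ext ρ′) t) (rename-cong (ext-∘ ρ ρ′) t))
rename-∘ ρ ρ′ (app t u) = cong₂ app (rename-∘ ρ ρ′ t) (rename-∘ ρ ρ′ u)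

exts-cong : ∀ {σ σ′ : ℕ → Tm} → (∀ x → σ x ≡ σ′ x) → ∀ x → exts σ x ≡ exts σ′ x
exts-cong h zero    = refl
exts-cong h (suc x) = cong wk (h x)

subst-cong : ∀ {σ σ′ : ℕ → Tm} → (∀ x → σ x ≡ σ′ x) → ∀ t → subst σ t ≡ subst σ′ t
subst-cong h (var x)   = h x
subst-cong h (lam t)   = cong lam (subst-cong (exts-cong h) t)
subst-cong h (app t u) = cong₂ app (subst-cong h t) (subst-cong h u)

exts-ext : ∀ (σ : ℕ → Tm) (ρ : ℕ → ℕ) x → exts σ (ext ρ x) ≡ exts (σ ∘ ρ) x
exts-ext σ ρ zero    = refl
exts-ext σ ρ (suc x) = refl

subst-rename : ∀ (σ : ℕ → Tm) (ρ : ℕ → ℕ) t → subst σ (rename ρ t) ≡ subst (σ ∘ ρ) t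
subst-rename σ ρ (var x)   = refl
subst-rename σ ρ (lam t)   =
  cong lam (trans (subst-rename (exts σ) (ext ρ) t) (subst-cong (exts-ext σ ρ) t))
subst-rename σ ρ (app t u) = cong₂ app (subst-rename σ ρ t) (subst-rename σ ρ u)

ext-exts : ∀ (ρ : ℕ → ℕ) (σ : ℕ → Tm) x → rename (ext ρ) (exts σ x) ≡ exts (rename ρ ∘ σ) x
ext-exts ρ σ zero    = refl
ext-exts ρ σ (suc x) = trans (rename-∘ (ext ρ) suc (σ x)) (sym (rename-∘ suc ρ (σ x)))

rename-subst : ∀ (ρ : ℕ → ℕ) (σ : ℕ → Tm) t → rename ρ (subst σ t) ≡ subst (rename ρ ∘ σ) t
rename-subst ρ σ (var x)   = refl
rename-subst ρ σ (lam t)   =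
  cong lam (trans (rename-subst (ext ρ) (exts σ) t) (subst-cong (ext-exts ρ σ) t))
rename-subst ρ σ (app t u) = cong₂ app (rename-subst ρ σ t) (rename-subst ρ σ u)

subst-id : ∀ {σ : ℕ → Tm} → (∀ x → σ x ≡ var x) → ∀ t → subst σ t ≡ t
subst-id h (var x)   = h x
subst-id h (lam t)   = cong lam (subst-id h′ t)
  where
  h′ : ∀ x → exts _ x ≡ var x
  h′ zero    = refl
  h′ (suc x) = cong wk (h x)
subst-id h (app t u) = cong₂ app (subst-id h t) (subst-id h u)

wk-[] : ∀ u w → wk u [ w ] ≡ u
wk-[] u w = trans (subst-rename (single w) suc u) (subst-id (λ _ → refl) u)

wk1-exts-[] : ∀ t w → subst (exts (single w)) (wk1 t) ≡ t
wk1-exts-[] t w = trans (subst-rename (exts (single w)) (ext suc) t) (subst-id h t)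
  where
  h : ∀ x → exts (single w) (ext suc x) ≡ var x
  h zero    = refl
  h (suc x) = refl

rename-ext-wk : ∀ ρ u → rename (ext ρ) (wk u) ≡ wk (rename ρ u)
rename-ext-wk ρ u = trans (rename-∘ (ext ρ) suc u) (sym (rename-∘ suc ρ u))

rename-ext-wk1 : ∀ ρ t → rename (ext (ext ρ)) (wk1 t) ≡ wk1 (rename (ext ρ) t)
rename-ext-wk1 ρ t =
  trans (rename-∘ (ext (ext ρ)) (ext suc) t)
        (trans (rename-cong h t) (sym (rename-∘ (ext suc) (ext ρ) t)))
  where
  h : ∀ x → ext (ext ρ) (ext suc x) ≡ ext suc (ext ρ x)
  h zero    = refl
  h (suc x) = refl

subst-exts-wk : ∀ σ u → subst (exts σ) (wk u) ≡ wk (subst σ u)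
subst-exts-wk σ u = trans (subst-rename (exts σ) suc u) (sym (rename-subst suc σ u))

subst-exts-wk1 : ∀ σ t → subst (exts (exts σ)) (wk1 t) ≡ wk1 (subst (exts σ) t)
subst-exts-wk1 σ t =
  trans (subst-rename (exts (exts σ)) (ext suc) t)
        (trans (subst-cong h t) (sym (rename-subst (ext suc) (exts σ) t)))
  where
  h : ∀ x → exts (exts σ) (ext suc x) ≡ wk1 (exts σ x)
  h zero    = refl
  h (suc x) = trans (rename-∘ suc suc (σ x)) (sym (rename-∘ (ext suc) suc (σ x)))

rename-value : ∀ ρ {v} → Value v → Value (rename ρ v)
rename-value ρ (var x) = var _
rename-value ρ (lam t) = lam _

subst-value : ∀ {σ} → (∀ x → Value (σ x)) → ∀ {v} → Value v → Value (subst σ v)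
subst-value h (var x) = h x
subst-value h (lam t) = lam _

-- Left reduction and its normal forms

infixr 9 _∘L_

_∘L_ : LCtx → LCtx → LCtx
hole       ∘L L′ = L′
vapp v w L ∘L L′ = vapp v w (L ∘L L′)
lapp L t   ∘L L′ = lapp (L ∘L L′) t

plugL-∘L : ∀ L L′ a → plugL (L ∘L L′) a ≡ plugL L (plugL L′ a)
plugL-∘L hole         L′ a = refl
plugL-∘L (vapp v _ L) L′ a = cong (app v) (plugL-∘L L L′ a)
plugL-∘L (lapp L t)   L′ a = cong (λ X → app X t) (plugL-∘L L L′ a)

→l-plugL : ∀ L {a b} → a →l b → plugL L a →l plugL L b
→l-plugL L (ctx L′ {r} {r′} st) = subst₂ _→l_ (plugL-∘L L L′ r) (plugL-∘L L L′ r′) (ctx (L ∘L L′) st)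

→l*-plugL : ∀ L {a b} → a →l* b → plugL L a →l* plugL L b
→l*-plugL L = gmap (plugL L) (→l-plugL L)

→l*-appˡ : ∀ u {a b} → a →l* b → app a u →l* app b u
→l*-appˡ u = →l*-plugL (lapp hole u)

→l*-appʳ : ∀ {v} → Value v → ∀ {a b} → a →l* b → app v a →l* app v b
→l*-appʳ w = →l*-plugL (vapp _ w hole)

β→l-≡ : ∀ {b w x} → Value w → b [ w ] ≡ x → app (lam b) w →l x
β→l-≡ {b} {w} vw refl = ctx hole (βv b w vw)

β→l : ∀ {b w} → Value w → app (lam b) w →l (b [ w ])
β→l vw = β→l-≡ vw refl

app-injective : ∀ {a b c d} → app a b ≡ app c d → a ≡ c × b ≡ d
app-injective refl = refl , refl

value≢plugL-app : ∀ {w a b} → Value w → ∀ L → w ≢ plugL L (app a b)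
value≢plugL-app (var _) hole ()
value≢plugL-app (var _) (vapp _ _ _) ()
value≢plugL-app (var _) (lapp _ _) ()
value≢plugL-app (lam _) hole ()
value≢plugL-app (lam _) (vapp _ _ _) ()
value≢plugL-app (lam _) (lapp _ _) ()

value↛ : ∀ {a b} → Value a → ¬ (a →l b)
value↛ va (ctx L (βv t v _)) = value≢plugL-app va L refl

data AppStep : Tm → Tm → Tm → Set where
  left  : ∀ {t t₁ u} → t →l t₁ → AppStep t u (app t₁ u)
  right : ∀ {t u u₁} → Value t → u →l u₁ → AppStep t u (app t u₁)
  beta  : ∀ {b u} → Value u → AppStep (lam b) u (b [ u ])

app-step-inv : ∀ {t u x} → app t u →l x → AppStep t u x
app-step-inv s = inv s refl
  where
  inv′ : ∀ L {r r′ t u} → r ↦ r′ → plugL L r ≡ app t u → AppStep t u (plugL L r′)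
  inv′ hole          (βv b v vv) refl = beta vv
  inv′ (vapp v vv L) st          refl = right vv (ctx L st)
  inv′ (lapp L t)    st          refl = left (ctx L st)

  inv : ∀ {a x t u} → a →l x → a ≡ app t u → AppStep t u x
  inv (ctx L st) = inv′ L st

→l-deterministic : ∀ {a b c} → a →l b → a →l c → b ≡ c
→l-deterministic {var _} s _ = ⊥-elim (value↛ (var _) s)
→l-deterministic {lam _} s _ = ⊥-elim (value↛ (lam _) s)
→l-deterministic {app t u} s₁ s₂ with app-step-inv s₁ | app-step-inv s₂
... | left x₁    | left x₂    = cong (λ X → app X u) (→l-deterministic x₁ x₂)
... | left x₁    | right vt _ = ⊥-elim (value↛ vt x₁)
... | left x₁    | beta _     = ⊥-elim (value↛ (lam _) x₁)
... | right vt _ | left x₂    = ⊥-elim (value↛ vt x₂)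
... | right _ x₁ | right _ x₂ = cong (app t) (→l-deterministic x₁ x₂)
... | right _ x₁ | beta vu    = ⊥-elim (value↛ vu x₁)
... | beta _     | left x₂    = ⊥-elim (value↛ (lam _) x₂)
... | beta vu    | right _ x₂ = ⊥-elim (value↛ vu x₂)
... | beta _     | beta _     = refl

data Stuck : Tm → Set where
  var-app : ∀ x {v} → Value v → Stuck (app (var x) v)
  appˡ    : ∀ {t} u → Stuck t → Stuck (app t u)
  appʳ    : ∀ {v t} → Value v → Stuck t → Stuck (app v t)

Nf : Tm → Set
Nf t = Value t ⊎ Stuck t

value-¬stuck : ∀ {t} → Value t → ¬ Stuck t
value-¬stuck (var x) ()
value-¬stuck (lam t) ()

stuck↛ : ∀ {t y} → Stuck t → ¬ (t →l y)
stuck↛ (var-app x vv) s with app-step-inv s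
... | left s₁     = value↛ (var x) s₁
... | right _ s₁  = value↛ vv s₁
stuck↛ (appˡ u st) s with app-step-inv s
... | left s₁     = stuck↛ st s₁
... | right vt _  = value-¬stuck vt st
... | beta _      = value-¬stuck (lam _) st
stuck↛ (appʳ vv st) s with app-step-inv s
... | left s₁     = value↛ vv s₁
... | right _ s₁  = stuck↛ st s₁
... | beta vu     = value-¬stuck vu st

Nf⇒Normal : ∀ {t} → Nf t → Normal t
Nf⇒Normal (inj₁ v)  (_ , s) = value↛ v s
Nf⇒Normal (inj₂ st) (_ , s) = stuck↛ st s

Normal⇒Nf : ∀ {t} → Normal t → Nf t
Normal⇒Nf {var x} _ = inj₁ (var x)
Normal⇒Nf {lam t} _ = inj₁ (lam t)
Normal⇒Nf {app t u} n with Normal⇒Nf {t} (λ (_ , s) → n (_ , →l-plugL (lapp hole u) s))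
... | inj₂ st = inj₂ (appˡ u st)
... | inj₁ vt with Normal⇒Nf {u} (λ (_ , s) → n (_ , →l-plugL (vapp t vt hole) s))
...   | inj₂ st = inj₂ (appʳ vt st)
...   | inj₁ vu with vt
...     | var x = inj₂ (var-app x vu)
...     | lam b = ⊥-elim (n (_ , β→l vu))

Normal-→l* : ∀ {a b} → Normal a → a →l* b → a ≡ b
Normal-→l* n ε       = refl
Normal-→l* n (s ◅ _) = ⊥-elim (n (_ , s))

-- The relation generated by the valid axioms

I : Tm
I = lam (var zero)

infix 4 _~_

data _~_ : Tm → Tm → Set where
  var    : ∀ x → var x ~ var x
  lam    : ∀ {t t′} → t ~ t′ → lam t ~ lam t′
  app    : ∀ {t t′ u u′} → t ~ t′ → u ~ u′ → app t u ~ app t′ u′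
  id⁺    : ∀ {t t′} → t ~ t′ → app I t ~ t′
  id⁻    : ∀ {t t′} → t ~ t′ → t ~ app I t′
  assoc⁺ : ∀ {t t′ u u′ s s′} → t ~ t′ → u ~ u′ → s ~ s′ →
           app (lam t) (app (lam u) s) ~ app (lam (app (lam (wk1 t′)) u′)) s′
  assoc⁻ : ∀ {t t′ u u′ s s′} → t ~ t′ → u ~ u′ → s ~ s′ →
           app (lam (app (lam (wk1 t)) u)) s ~ app (lam t′) (app (lam u′) s′)
  ldec⁺  : ∀ {t t′ u u′} → t ~ t′ → u ~ u′ → app t u ~ app (lam (app (var zero) (wk u′))) t′
  ldec⁻  : ∀ {t t′ u u′} → t ~ t′ → u ~ u′ → app (lam (app (var zero) (wk u))) t ~ app t′ u′
  rdec⁺  : ∀ {v v′ t t′} → Value v → Value v′ → v ~ v′ → t ~ t′ →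
           app v t ~ app (lam (app (wk v′) (var zero))) t′
  rdec⁻  : ∀ {v v′ t t′} → Value v → Value v′ → v ~ v′ → t ~ t′ →
           app (lam (app (wk v) (var zero))) t ~ app v′ t′
  lapp⁺  : ∀ {t t′ u u′ s s′} → t ~ t′ → u ~ u′ → s ~ s′ →
           app (app (lam t) u) s ~ app (lam (app t′ (wk s′))) u′
  lapp⁻  : ∀ {t t′ u u′ s s′} → t ~ t′ → u ~ u′ → s ~ s′ →
           app (lam (app t (wk s))) u ~ app (app (lam t′) u′) s′
  vrapp⁺ : ∀ {v v′ u u′ s s′} → Value v → Value v′ → v ~ v′ → u ~ u′ → s ~ s′ →
           app v (app (lam u) s) ~ app (lam (app (wk v′) u′)) s′
  vrapp⁻ : ∀ {v v′ u u′ s s′} → Value v → Value v′ → v ~ v′ → u ~ u′ → s ~ s′ →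
           app (lam (app (wk v) u)) s ~ app v′ (app (lam u′) s′)

~-refl : ∀ t → t ~ t
~-refl (var x)   = var x
~-refl (lam t)   = lam (~-refl t)
~-refl (app t u) = app (~-refl t) (~-refl u)

~-sym : ∀ {t t′} → t ~ t′ → t′ ~ t
~-sym (var x)            = var x
~-sym (lam p)            = lam (~-sym p)
~-sym (app p q)          = app (~-sym p) (~-sym q)
~-sym (id⁺ p)            = id⁻ (~-sym p)
~-sym (id⁻ p)            = id⁺ (~-sym p)
~-sym (assoc⁺ p q r)     = assoc⁻ (~-sym p) (~-sym q) (~-sym r)
~-sym (assoc⁻ p q r)     = assoc⁺ (~-sym p) (~-sym q) (~-sym r)
~-sym (ldec⁺ p q)        = ldec⁻ (~-sym p) (~-sym q)
~-sym (ldec⁻ p q)        = ldec⁺ (~-sym p) (~-sym q)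
~-sym (rdec⁺ a b p q)    = rdec⁻ b a (~-sym p) (~-sym q)
~-sym (rdec⁻ a b p q)    = rdec⁺ b a (~-sym p) (~-sym q)
~-sym (lapp⁺ p q r)      = lapp⁻ (~-sym p) (~-sym q) (~-sym r)
~-sym (lapp⁻ p q r)      = lapp⁺ (~-sym p) (~-sym q) (~-sym r)
~-sym (vrapp⁺ a b p q r) = vrapp⁻ b a (~-sym p) (~-sym q) (~-sym r)
~-sym (vrapp⁻ a b p q r) = vrapp⁺ b a (~-sym p) (~-sym q) (~-sym r)

~-plug : ∀ C {l r} → l ~ r → plug C l ~ plug C r
~-plug hole       p = p
~-plug (appR t C) p = app (~-refl t) (~-plug C p)
~-plug (appL C t) p = app (~-plug C p) (~-refl t)
~-plug (lamC C)   p = lam (~-plug C p)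

~-respˡ-≡ : ∀ {a b c} → a ≡ b → a ~ c → b ~ c
~-respˡ-≡ refl p = p

~-respʳ-≡ : ∀ {a b c} → b ≡ c → a ~ b → a ~ c
~-respʳ-≡ refl p = p

~-rename : ∀ ρ {t t′} → t ~ t′ → rename ρ t ~ rename ρ t′
~-rename ρ (var x)   = var _
~-rename ρ (lam p)   = lam (~-rename (ext ρ) p)
~-rename ρ (app p q) = app (~-rename ρ p) (~-rename ρ q)
~-rename ρ (id⁺ p)   = id⁺ (~-rename ρ p)
~-rename ρ (id⁻ p)   = id⁻ (~-rename ρ p)
~-rename ρ (assoc⁺ {t′ = t′} p q r) =
  ~-respʳ-≡ (cong (λ X → app (lam (app (lam X) _)) _) (sym (rename-ext-wk1 ρ t′)))
    (assoc⁺ (~-rename (ext ρ) p) (~-rename (ext ρ) q) (~-rename ρ r))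
~-rename ρ (assoc⁻ {t = t} p q r) =
  ~-respˡ-≡ (cong (λ X → app (lam (app (lam X) _)) _) (sym (rename-ext-wk1 ρ t)))
    (assoc⁻ (~-rename (ext ρ) p) (~-rename (ext ρ) q) (~-rename ρ r))
~-rename ρ (ldec⁺ {u′ = u′} p q) =
  ~-respʳ-≡ (cong (λ X → app (lam (app (var zero) X)) _) (sym (rename-ext-wk ρ u′)))
    (ldec⁺ (~-rename ρ p) (~-rename ρ q))
~-rename ρ (ldec⁻ {u = u} p q) =
  ~-respˡ-≡ (cong (λ X → app (lam (app (var zero) X)) _) (sym (rename-ext-wk ρ u)))
    (ldec⁻ (~-rename ρ p) (~-rename ρ q))
~-rename ρ (rdec⁺ {v′ = v′} a b p q) =
  ~-respʳ-≡ (cong (λ X → app (lam (app X (var zero))) _) (sym (rename-ext-wk ρ v′)))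
    (rdec⁺ (rename-value ρ a) (rename-value ρ b) (~-rename ρ p) (~-rename ρ q))
~-rename ρ (rdec⁻ {v = v} a b p q) =
  ~-respˡ-≡ (cong (λ X → app (lam (app X (var zero))) _) (sym (rename-ext-wk ρ v)))
    (rdec⁻ (rename-value ρ a) (rename-value ρ b) (~-rename ρ p) (~-rename ρ q))
~-rename ρ (lapp⁺ {s′ = s′} p q r) =
  ~-respʳ-≡ (cong (λ X → app (lam (app _ X)) _) (sym (rename-ext-wk ρ s′)))
    (lapp⁺ (~-rename (ext ρ) p) (~-rename ρ q) (~-rename ρ r))
~-rename ρ (lapp⁻ {s = s} p q r) =
  ~-respˡ-≡ (cong (λ X → app (lam (app _ X)) _) (sym (rename-ext-wk ρ s)))
    (lapp⁻ (~-rename (ext ρ) p) (~-rename ρ q) (~-rename ρ r))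
~-rename ρ (vrapp⁺ {v′ = v′} a b p q r) =
  ~-respʳ-≡ (cong (λ X → app (lam (app X _)) _) (sym (rename-ext-wk ρ v′)))
    (vrapp⁺ (rename-value ρ a) (rename-value ρ b) (~-rename ρ p) (~-rename (ext ρ) q) (~-rename ρ r))
~-rename ρ (vrapp⁻ {v = v} a b p q r) =
  ~-respˡ-≡ (cong (λ X → app (lam (app X _)) _) (sym (rename-ext-wk ρ v)))
    (vrapp⁻ (rename-value ρ a) (rename-value ρ b) (~-rename ρ p) (~-rename (ext ρ) q) (~-rename ρ r))

record _~ˢ_ (σ σ′ : ℕ → Tm) : Set where
  field
    related : ∀ x → σ x ~ σ′ x
    valueˡ  : ∀ x → Value (σ x)
    valueʳ  : ∀ x → Value (σ′ x)
open _~ˢ_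

exts-~ˢ : ∀ {σ σ′} → σ ~ˢ σ′ → exts σ ~ˢ exts σ′
exts-~ˢ h .related zero    = var zero
exts-~ˢ h .related (suc x) = ~-rename suc (related h x)
exts-~ˢ h .valueˡ  zero    = var zero
exts-~ˢ h .valueˡ  (suc x) = rename-value suc (valueˡ h x)
exts-~ˢ h .valueʳ  zero    = var zero
exts-~ˢ h .valueʳ  (suc x) = rename-value suc (valueʳ h x)

~-subst : ∀ {σ σ′} → σ ~ˢ σ′ → ∀ {t t′} → t ~ t′ → subst σ t ~ subst σ′ t′
~-subst h (var x)   = related h x
~-subst h (lam p)   = lam (~-subst (exts-~ˢ h) p)
~-subst h (app p q) = app (~-subst h p) (~-subst h q)
~-subst h (id⁺ p)   = id⁺ (~-subst h p)
~-subst h (id⁻ p)   = id⁻ (~-subst h p)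
~-subst {σ′ = σ′} h (assoc⁺ {t′ = t′} p q r) =
  ~-respʳ-≡ (cong (λ X → app (lam (app (lam X) _)) _) (sym (subst-exts-wk1 σ′ t′)))
    (assoc⁺ (~-subst (exts-~ˢ h) p) (~-subst (exts-~ˢ h) q) (~-subst h r))
~-subst {σ} h (assoc⁻ {t = t} p q r) =
  ~-respˡ-≡ (cong (λ X → app (lam (app (lam X) _)) _) (sym (subst-exts-wk1 σ t)))
    (assoc⁻ (~-subst (exts-~ˢ h) p) (~-subst (exts-~ˢ h) q) (~-subst h r))
~-subst {σ′ = σ′} h (ldec⁺ {u′ = u′} p q) =
  ~-respʳ-≡ (cong (λ X → app (lam (app (var zero) X)) _) (sym (subst-exts-wk σ′ u′)))
    (ldec⁺ (~-subst h p) (~-subst h q))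
~-subst {σ} h (ldec⁻ {u = u} p q) =
  ~-respˡ-≡ (cong (λ X → app (lam (app (var zero) X)) _) (sym (subst-exts-wk σ u)))
    (ldec⁻ (~-subst h p) (~-subst h q))
~-subst {σ′ = σ′} h (rdec⁺ {v′ = v′} a b p q) =
  ~-respʳ-≡ (cong (λ X → app (lam (app X (var zero))) _) (sym (subst-exts-wk σ′ v′)))
    (rdec⁺ (subst-value (valueˡ h) a) (subst-value (valueʳ h) b) (~-subst h p) (~-subst h q))
~-subst {σ} h (rdec⁻ {v = v} a b p q) =
  ~-respˡ-≡ (cong (λ X → app (lam (app X (var zero))) _) (sym (subst-exts-wk σ v)))
    (rdec⁻ (subst-value (valueˡ h) a) (subst-value (valueʳ h) b) (~-subst h p) (~-subst h q))
~-subst {σ′ = σ′} h (lapp⁺ {s′ = s′} p q r) =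
  ~-respʳ-≡ (cong (λ X → app (lam (app _ X)) _) (sym (subst-exts-wk σ′ s′)))
    (lapp⁺ (~-subst (exts-~ˢ h) p) (~-subst h q) (~-subst h r))
~-subst {σ} h (lapp⁻ {s = s} p q r) =
  ~-respˡ-≡ (cong (λ X → app (lam (app _ X)) _) (sym (subst-exts-wk σ s)))
    (lapp⁻ (~-subst (exts-~ˢ h) p) (~-subst h q) (~-subst h r))
~-subst {σ′ = σ′} h (vrapp⁺ {v′ = v′} a b p q r) =
  ~-respʳ-≡ (cong (λ X → app (lam (app X _)) _) (sym (subst-exts-wk σ′ v′)))
    (vrapp⁺ (subst-value (valueˡ h) a) (subst-value (valueʳ h) b)
            (~-subst h p) (~-subst (exts-~ˢ h) q) (~-subst h r))
~-subst {σ} h (vrapp⁻ {v = v} a b p q r) =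
  ~-respˡ-≡ (cong (λ X → app (lam (app X _)) _) (sym (subst-exts-wk σ v)))
    (vrapp⁻ (subst-value (valueˡ h) a) (subst-value (valueʳ h) b)
            (~-subst h p) (~-subst (exts-~ˢ h) q) (~-subst h r))

~-[] : ∀ {b b′ w w′} → b ~ b′ → w ~ w′ → Value w → Value w′ → (b [ w ]) ~ (b′ [ w′ ])
~-[] p q a b = ~-subst single~ˢ p
  where
  single~ˢ : single _ ~ˢ single _
  single~ˢ .related zero    = q
  single~ˢ .related (suc x) = var x
  single~ˢ .valueˡ  zero    = a
  single~ˢ .valueˡ  (suc x) = var x
  single~ˢ .valueʳ  zero    = b
  single~ˢ .valueʳ  (suc x) = var x

-- Simulating left reduction up to ~

var~value : ∀ {x w} → var x ~ w → Value w → w ≡ var x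
var~value (var x) _  = refl
var~value (id⁻ p) ()

lam~value : ∀ {b w} → lam b ~ w → Value w → ∃[ b′ ] (w ≡ lam b′ × b ~ b′)
lam~value (lam p) _  = _ , refl , p
lam~value (id⁻ p) ()

value≁stuck : ∀ {t t′} → t ~ t′ → Value t → ¬ Stuck t′
value≁stuck (id⁻ p) vt (appʳ _ st) = value≁stuck p vt st
value≁stuck (id⁻ p) vt (appˡ _ ())
value≁stuck (var x) vt ()
value≁stuck (lam p) vt ()

stuck≁value : ∀ {t t′} → t ~ t′ → Stuck t → ¬ Value t′
stuck≁value p st vt′ = value≁stuck (~-sym p) vt′ st

~-stuck-nf : ∀ {t t′} → t ~ t′ → Stuck t → Nf t′ → Stuck t′
~-stuck-nf p st (inj₁ v′)  = ⊥-elim (stuck≁value p st v′)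
~-stuck-nf p st (inj₂ st′) = st′

~-value-nf : ∀ {t t′} → t ~ t′ → Value t → Nf t′ → Value t′
~-value-nf p v (inj₁ v′)  = v′
~-value-nf p v (inj₂ st′) = ⊥-elim (value≁stuck p v st′)

stuck-λ-arg : ∀ {b t} → Stuck (app (lam b) t) → Stuck t
stuck-λ-arg (appˡ _ ())
stuck-λ-arg (appʳ _ st) = st

nf-λ-arg : ∀ {b t} → Nf (app (lam b) t) → Stuck t
nf-λ-arg (inj₁ ())
nf-λ-arg (inj₂ st) = stuck-λ-arg st

record Tracks (t t′ : Tm) : Set where
  constructor tracks
  field
    {target} : Tm
    reduces  : t′ →l* target
    related  : t ~ target

record TracksNf (t t′ : Tm) : Set where
  constructor tracksNf
  field
    {target} : Tm
    reduces  : t′ →l* target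
    normal   : Nf target
    related  : t ~ target

mutual
  nf-tracked : ∀ {t t′} → t ~ t′ → Nf t → TracksNf t t′
  nf-tracked (var x) _ = tracksNf ε (inj₁ (var x)) (var x)
  nf-tracked (lam p) _ = tracksNf ε (inj₁ (lam _)) (lam p)
  nf-tracked (app pt pu) (inj₁ ())
  nf-tracked (app {u′ = u′} pt pu) (inj₂ (appˡ u st)) with nf-tracked pt (inj₂ st)
  ... | tracksNf r nf rel = tracksNf (→l*-appˡ u′ r) (inj₂ (appˡ u′ (~-stuck-nf rel st nf))) (app rel pu)
  nf-tracked (app pt pu) (inj₂ (appʳ vt st)) = app-tracked vt pt pu (inj₂ (appʳ vt st))
  nf-tracked (app pt pu) (inj₂ (var-app x vu)) = app-tracked (var x) pt pu (inj₂ (var-app x vu))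
  nf-tracked (id⁺ p) (inj₁ ())
  nf-tracked (id⁺ p) (inj₂ (appˡ _ ()))
  nf-tracked (id⁺ p) (inj₂ (appʳ _ st)) with nf-tracked p (inj₂ st)
  ... | tracksNf r nf rel = tracksNf r nf (id⁺ rel)
  nf-tracked (id⁻ p) nf₀ with nf-tracked p nf₀
  ... | tracksNf r (inj₁ vw) rel = tracksNf (→l*-appʳ (lam _) r ◅◅ (β→l vw ◅ ε)) (inj₁ vw) rel
  ... | tracksNf r (inj₂ st) rel = tracksNf (→l*-appʳ (lam _) r) (inj₂ (appʳ (lam _) st)) (id⁻ rel)
  nf-tracked (assoc⁺ pt pu ps) nf₀ with nf-tracked ps (inj₂ (stuck-λ-arg (nf-λ-arg nf₀)))
  ... | tracksNf r nf rel =
        tracksNf (→l*-appʳ (lam _) r)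
                 (inj₂ (appʳ (lam _) (~-stuck-nf rel (stuck-λ-arg (nf-λ-arg nf₀)) nf)))
                 (assoc⁺ pt pu rel)
  nf-tracked (assoc⁻ pt pu ps) nf₀ with nf-tracked ps (inj₂ (nf-λ-arg nf₀))
  ... | tracksNf r nf rel =
        tracksNf (→l*-plugL (vapp _ (lam _) (vapp _ (lam _) hole)) r)
                 (inj₂ (appʳ (lam _) (appʳ (lam _) (~-stuck-nf rel (nf-λ-arg nf₀) nf))))
                 (assoc⁻ pt pu rel)
  nf-tracked (ldec⁺ pt pu) (inj₁ ())
  nf-tracked (ldec⁺ pt pu) (inj₂ (appˡ _ st)) with nf-tracked pt (inj₂ st)
  ... | tracksNf r nf rel =
        tracksNf (→l*-appʳ (lam _) r) (inj₂ (appʳ (lam _) (~-stuck-nf rel st nf))) (ldec⁺ rel pu)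
  nf-tracked (ldec⁺ pt pu) (inj₂ (appʳ vt st))    = ldec-tracked vt pt pu (inj₂ (appʳ vt st))
  nf-tracked (ldec⁺ pt pu) (inj₂ (var-app x vu))  = ldec-tracked (var x) pt pu (inj₂ (var-app x vu))
  nf-tracked (ldec⁻ {u′ = u′} pt pu) nf₀ with nf-tracked pt (inj₂ (nf-λ-arg nf₀))
  ... | tracksNf r nf rel =
        tracksNf (→l*-appˡ u′ r) (inj₂ (appˡ u′ (~-stuck-nf rel (nf-λ-arg nf₀) nf))) (ldec⁻ rel pu)
  nf-tracked (rdec⁺ a b pv pt) (inj₁ ())
  nf-tracked (rdec⁺ a b pv pt) (inj₂ (appˡ _ st)) = ⊥-elim (value-¬stuck a st)
  nf-tracked (rdec⁺ a b pv pt) (inj₂ (appʳ _ st)) with nf-tracked pt (inj₂ st)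
  ... | tracksNf r nf rel =
        tracksNf (→l*-appʳ (lam _) r) (inj₂ (appʳ (lam _) (~-stuck-nf rel st nf))) (rdec⁺ a b pv rel)
  nf-tracked (rdec⁺ a b pv pt) (inj₂ (var-app x vt)) with nf-tracked pt (inj₁ vt) | var~value pv b
  ... | tracksNf r nf rel | refl =
        tracksNf (→l*-appʳ (lam _) r ◅◅ (β→l (~-value-nf rel vt nf) ◅ ε))
                 (inj₂ (var-app x (~-value-nf rel vt nf))) (app pv rel)
  nf-tracked (rdec⁻ a b pv pt) nf₀ with nf-tracked pt (inj₂ (nf-λ-arg nf₀))
  ... | tracksNf r nf rel =
        tracksNf (→l*-appʳ b r) (inj₂ (appʳ b (~-stuck-nf rel (nf-λ-arg nf₀) nf))) (rdec⁻ a b pv rel)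
  nf-tracked (lapp⁺ pt pu ps) (inj₁ ())
  nf-tracked (lapp⁺ pt pu ps) (inj₂ (appˡ _ st)) with nf-tracked pu (inj₂ (stuck-λ-arg st))
  ... | tracksNf r nf rel =
        tracksNf (→l*-appʳ (lam _) r) (inj₂ (appʳ (lam _) (~-stuck-nf rel (stuck-λ-arg st) nf)))
                 (lapp⁺ pt rel ps)
  nf-tracked (lapp⁺ pt pu ps) (inj₂ (appʳ () _))
  nf-tracked (lapp⁻ {s′ = s′} pt pu ps) nf₀ with nf-tracked pu (inj₂ (nf-λ-arg nf₀))
  ... | tracksNf r nf rel =
        tracksNf (→l*-plugL (lapp (vapp _ (lam _) hole) s′) r)
                 (inj₂ (appˡ s′ (appʳ (lam _) (~-stuck-nf rel (nf-λ-arg nf₀) nf)))) (lapp⁻ pt rel ps)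
  nf-tracked (vrapp⁺ a b pv pu ps) (inj₁ ())
  nf-tracked (vrapp⁺ a b pv pu ps) (inj₂ (appˡ _ st)) = ⊥-elim (value-¬stuck a st)
  nf-tracked (vrapp⁺ a b pv pu ps) (inj₂ (appʳ _ st)) with nf-tracked ps (inj₂ (stuck-λ-arg st))
  ... | tracksNf r nf rel =
        tracksNf (→l*-appʳ (lam _) r) (inj₂ (appʳ (lam _) (~-stuck-nf rel (stuck-λ-arg st) nf)))
                 (vrapp⁺ a b pv pu rel)
  nf-tracked (vrapp⁻ a b pv pu ps) nf₀ with nf-tracked ps (inj₂ (nf-λ-arg nf₀))
  ... | tracksNf r nf rel =
        tracksNf (→l*-plugL (vapp _ b (vapp _ (lam _) hole)) r)
                 (inj₂ (appʳ b (appʳ (lam _) (~-stuck-nf rel (nf-λ-arg nf₀) nf)))) (vrapp⁻ a b pv pu rel)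

  app-tracked : ∀ {t t′ u u′} → Value t → t ~ t′ → u ~ u′ → Nf (app t u) → TracksNf (app t u) (app t′ u′)
  app-tracked {u′ = u′} vt pt pu nf₀ with nf-tracked pt (inj₁ vt)
  ... | tracksNf r nf rel with value-app-tracked vt rel (~-value-nf rel vt nf) pu nf₀
  ...   | tracksNf r₂ nf₂ rel₂ = tracksNf (→l*-appˡ u′ r ◅◅ r₂) nf₂ rel₂

  ldec-tracked : ∀ {t t′ u u′} → Value t → t ~ t′ → u ~ u′ → Nf (app t u) →
                 TracksNf (app t u) (app (lam (app (var zero) (wk u′))) t′)
  ldec-tracked {u′ = u′} vt pt pu nf₀ with nf-tracked pt (inj₁ vt)
  ... | tracksNf r nf rel with value-app-tracked vt rel (~-value-nf rel vt nf) pu nf₀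
  ...   | tracksNf r₂ nf₂ rel₂ =
          tracksNf (→l*-appʳ (lam _) r ◅◅ (β→l-≡ (~-value-nf rel vt nf) (cong (app _) (wk-[] u′ _)) ◅ r₂))
                   nf₂ rel₂

  value-app-tracked : ∀ {t w u u′} → Value t → t ~ w → Value w → u ~ u′ → Nf (app t u) →
                      TracksNf (app t u) (app w u′)
  value-app-tracked vt pw vw pu (inj₁ ())
  value-app-tracked vt pw vw pu (inj₂ (appˡ _ st)) = ⊥-elim (value-¬stuck vt st)
  value-app-tracked vt pw vw pu (inj₂ (appʳ _ st)) with nf-tracked pu (inj₂ st)
  ... | tracksNf r nf rel = tracksNf (→l*-appʳ vw r) (inj₂ (appʳ vw (~-stuck-nf rel st nf))) (app pw rel)
  value-app-tracked vt pw vw pu (inj₂ (var-app x vu)) with nf-tracked pu (inj₁ vu) | var~value pw vw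
  ... | tracksNf r nf rel | refl =
        tracksNf (→l*-appʳ vw r) (inj₂ (var-app x (~-value-nf rel vu nf))) (app pw rel)

value-tracked : ∀ {t t′} → t ~ t′ → Value t → Σ Tm λ w → (t′ →l* w) × Value w × t ~ w
value-tracked p vt with nf-tracked p (inj₁ vt)
... | tracksNf r nf rel = _ , r , ~-value-nf rel vt nf , rel

β-tracked : ∀ {b t′ u u′} → lam b ~ t′ → u ~ u′ → Value u → Tracks (b [ u ]) (app t′ u′)
β-tracked {u′ = u′} pt pu vu with value-tracked pt (lam _) | value-tracked pu vu
... | w , r₁ , vw , rel₁ | w₂ , r₂ , vw₂ , rel₂ with lam~value rel₁ vw
...   | _ , refl , rb = tracks (→l*-appˡ u′ r₁ ◅◅ →l*-appʳ vw r₂ ◅◅ (β→l vw₂ ◅ ε)) (~-[] rb rel₂ vu vw₂)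

mutual
  step-tracked : ∀ {t t′ x} → t ~ t′ → t →l x → Tracks x t′
  step-tracked (var x) s = ⊥-elim (value↛ (var x) s)
  step-tracked (lam p) s = ⊥-elim (value↛ (lam _) s)
  step-tracked (app pt pu) s = app-step-tracked pt pu (app-step-inv s)
  step-tracked (id⁺ p) s = id⁺-step-tracked p (app-step-inv s)
  step-tracked (id⁻ p) s with step-tracked p s
  ... | tracks r rel = tracks (→l*-appʳ (lam _) r) (id⁻ rel)
  step-tracked (assoc⁺ pt pu ps) s = assoc⁺-step-tracked pt pu ps (app-step-inv s)
  step-tracked (assoc⁻ pt pu ps) s = assoc⁻-step-tracked pt pu ps (app-step-inv s)
  step-tracked (ldec⁺ pt pu) s = ldec⁺-step-tracked pt pu (app-step-inv s)
  step-tracked (ldec⁻ pt pu) s = ldec⁻-step-tracked pt pu (app-step-inv s)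
  step-tracked (rdec⁺ a b pv pt) s = rdec⁺-step-tracked a b pv pt (app-step-inv s)
  step-tracked (rdec⁻ a b pv pt) s = rdec⁻-step-tracked a b pv pt (app-step-inv s)
  step-tracked (lapp⁺ pt pu ps) s = lapp⁺-step-tracked pt pu ps (app-step-inv s)
  step-tracked (lapp⁻ pt pu ps) s = lapp⁻-step-tracked pt pu ps (app-step-inv s)
  step-tracked (vrapp⁺ a b pv pu ps) s = vrapp⁺-step-tracked a b pv pu ps (app-step-inv s)
  step-tracked (vrapp⁻ a b pv pu ps) s = vrapp⁻-step-tracked a b pv pu ps (app-step-inv s)

  app-step-tracked : ∀ {t t′ u u′ x} → t ~ t′ → u ~ u′ → AppStep t u x → Tracks x (app t′ u′)
  app-step-tracked {u′ = u′} pt pu (left s) with step-tracked pt s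
  ... | tracks r rel = tracks (→l*-appˡ u′ r) (app rel pu)
  app-step-tracked {u′ = u′} pt pu (right vt s) with value-tracked pt vt | step-tracked pu s
  ... | w , r₁ , vw , rel₁ | tracks r₂ rel₂ = tracks (→l*-appˡ u′ r₁ ◅◅ →l*-appʳ vw r₂) (app rel₁ rel₂)
  app-step-tracked pt pu (beta vu) = β-tracked pt pu vu

  id⁺-step-tracked : ∀ {t t′ x} → t ~ t′ → AppStep I t x → Tracks x t′
  id⁺-step-tracked p (left s)    = ⊥-elim (value↛ (lam _) s)
  id⁺-step-tracked p (right _ s) with step-tracked p s
  ... | tracks r rel = tracks r (id⁺ rel)
  id⁺-step-tracked p (beta _)    = tracks ε p

  assoc⁺-step-tracked : ∀ {t t′ u u′ s s′ x} → t ~ t′ → u ~ u′ → s ~ s′ →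
    AppStep (lam t) (app (lam u) s) x → Tracks x (app (lam (app (lam (wk1 t′)) u′)) s′)
  assoc⁺-step-tracked pt pu ps (left s)    = ⊥-elim (value↛ (lam _) s)
  assoc⁺-step-tracked pt pu ps (right _ s) = inner (app-step-inv s)
    where
    inner : ∀ {y} → AppStep (lam _) _ y → Tracks (app (lam _) y) _
    inner (left s₁)    = ⊥-elim (value↛ (lam _) s₁)
    inner (right _ s₁) with step-tracked ps s₁
    ... | tracks r rel = tracks (→l*-appʳ (lam _) r) (assoc⁺ pt pu rel)
    inner (beta vs) with value-tracked ps vs
    ... | w , r , vw , rel =
          tracks (→l*-appʳ (lam _) r ◅◅ (β→l-≡ vw (cong (λ X → app (lam X) _) (wk1-exts-[] _ w)) ◅ ε))
                 (app (lam pt) (~-[] pu rel vs vw))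
  assoc⁺-step-tracked pt pu ps (beta ())

  assoc⁻-step-tracked : ∀ {t t′ u u′ s s′ x} → t ~ t′ → u ~ u′ → s ~ s′ →
    AppStep (lam (app (lam (wk1 t)) u)) s x → Tracks x (app (lam t′) (app (lam u′) s′))
  assoc⁻-step-tracked pt pu ps (left s)    = ⊥-elim (value↛ (lam _) s)
  assoc⁻-step-tracked pt pu ps (right _ s) with step-tracked ps s
  ... | tracks r rel = tracks (→l*-plugL (vapp _ (lam _) (vapp _ (lam _) hole)) r) (assoc⁻ pt pu rel)
  assoc⁻-step-tracked {t = t} pt pu ps (beta vs) with value-tracked ps vs
  ... | w , r , vw , rel =
        tracks (→l*-plugL (vapp _ (lam _) (vapp _ (lam _) hole)) r ◅◅ (→l-plugL (vapp _ (lam _) hole) (β→l vw) ◅ ε))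
               (~-respˡ-≡ (cong (λ X → app (lam X) _) (sym (wk1-exts-[] t _))) (app (lam pt) (~-[] pu rel vs vw)))

  ldec⁺-step-tracked : ∀ {t t′ u u′ x} → t ~ t′ → u ~ u′ → AppStep t u x →
    Tracks x (app (lam (app (var zero) (wk u′))) t′)
  ldec⁺-step-tracked pt pu (left s) with step-tracked pt s
  ... | tracks r rel = tracks (→l*-appʳ (lam _) r) (ldec⁺ rel pu)
  ldec⁺-step-tracked {u′ = u′} pt pu (right vt s) with value-tracked pt vt | step-tracked pu s
  ... | w , r₁ , vw , rel₁ | tracks r₂ rel₂ =
        tracks (→l*-appʳ (lam _) r₁ ◅◅ (β→l-≡ vw (cong (app w) (wk-[] u′ w)) ◅ →l*-appʳ vw r₂)) (app rel₁ rel₂)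
  ldec⁺-step-tracked {u′ = u′} pt pu (beta vu) with value-tracked pt (lam _)
  ... | w , r₁ , vw , rel₁ with β-tracked rel₁ pu vu
  ...   | tracks r₃ rel₃ = tracks (→l*-appʳ (lam _) r₁ ◅◅ (β→l-≡ vw (cong (app w) (wk-[] u′ w)) ◅ r₃)) rel₃

  ldec⁻-step-tracked : ∀ {t t′ u u′ x} → t ~ t′ → u ~ u′ →
    AppStep (lam (app (var zero) (wk u))) t x → Tracks x (app t′ u′)
  ldec⁻-step-tracked pt pu (left s) = ⊥-elim (value↛ (lam _) s)
  ldec⁻-step-tracked {u′ = u′} pt pu (right _ s) with step-tracked pt s
  ... | tracks r rel = tracks (→l*-appˡ u′ r) (ldec⁻ rel pu)
  ldec⁻-step-tracked {t = t} {u = u} pt pu (beta _) =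
    tracks ε (~-respˡ-≡ (sym (cong (app t) (wk-[] u t))) (app pt pu))

  rdec⁺-step-tracked : ∀ {v v′ t t′ x} → Value v → Value v′ → v ~ v′ → t ~ t′ → AppStep v t x →
    Tracks x (app (lam (app (wk v′) (var zero))) t′)
  rdec⁺-step-tracked a b pv pt (left s) = ⊥-elim (value↛ a s)
  rdec⁺-step-tracked a b pv pt (right _ s) with step-tracked pt s
  ... | tracks r rel = tracks (→l*-appʳ (lam _) r) (rdec⁺ a b pv rel)
  rdec⁺-step-tracked {v′ = v′} a b pv pt (beta vt) with value-tracked pt vt
  ... | w , r₁ , vw , rel₁ with β-tracked pv rel₁ vt
  ...   | tracks r₃ rel₃ =
          tracks (→l*-appʳ (lam _) r₁ ◅◅ (β→l-≡ vw (cong (λ X → app X w) (wk-[] v′ w)) ◅ r₃)) rel₃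

  rdec⁻-step-tracked : ∀ {v v′ t t′ x} → Value v → Value v′ → v ~ v′ → t ~ t′ →
    AppStep (lam (app (wk v) (var zero))) t x → Tracks x (app v′ t′)
  rdec⁻-step-tracked a b pv pt (left s) = ⊥-elim (value↛ (lam _) s)
  rdec⁻-step-tracked a b pv pt (right _ s) with step-tracked pt s
  ... | tracks r rel = tracks (→l*-appʳ b r) (rdec⁻ a b pv rel)
  rdec⁻-step-tracked {v = v} {t = t} a b pv pt (beta _) =
    tracks ε (~-respˡ-≡ (sym (cong (λ X → app X t) (wk-[] v t))) (app pv pt))

  lapp⁺-step-tracked : ∀ {t t′ u u′ s s′ x} → t ~ t′ → u ~ u′ → s ~ s′ →
    AppStep (app (lam t) u) s x → Tracks x (app (lam (app t′ (wk s′))) u′)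
  lapp⁺-step-tracked {s′ = s′} pt pu ps (left s) = inner (app-step-inv s)
    where
    inner : ∀ {y} → AppStep (lam _) _ y → Tracks (app y _) _
    inner (left s₁)    = ⊥-elim (value↛ (lam _) s₁)
    inner (right _ s₁) with step-tracked pu s₁
    ... | tracks r rel = tracks (→l*-appʳ (lam _) r) (lapp⁺ pt rel ps)
    inner (beta vu) with value-tracked pu vu
    ... | w , r , vw , rel =
          tracks (→l*-appʳ (lam _) r ◅◅ (β→l-≡ vw (cong (app _) (wk-[] s′ w)) ◅ ε)) (app (~-[] pt rel vu vw) ps)
  lapp⁺-step-tracked pt pu ps (right () _)

  lapp⁻-step-tracked : ∀ {t t′ u u′ s s′ x} → t ~ t′ → u ~ u′ → s ~ s′ →
    AppStep (lam (app t (wk s))) u x → Tracks x (app (app (lam t′) u′) s′)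
  lapp⁻-step-tracked pt pu ps (left s) = ⊥-elim (value↛ (lam _) s)
  lapp⁻-step-tracked {s′ = s′} pt pu ps (right _ s) with step-tracked pu s
  ... | tracks r rel = tracks (→l*-plugL (lapp (vapp _ (lam _) hole) s′) r) (lapp⁻ pt rel ps)
  lapp⁻-step-tracked {s = s} {s′ = s′} pt pu ps (beta vu) with value-tracked pu vu
  ... | w , r , vw , rel =
        tracks (→l*-plugL (lapp (vapp _ (lam _) hole) s′) r ◅◅ (→l-plugL (lapp hole s′) (β→l vw) ◅ ε))
               (~-respˡ-≡ (sym (cong (app _) (wk-[] s _))) (app (~-[] pt rel vu vw) ps))

  vrapp⁺-step-tracked : ∀ {v v′ u u′ s s′ x} → Value v → Value v′ → v ~ v′ → u ~ u′ → s ~ s′ →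
    AppStep v (app (lam u) s) x → Tracks x (app (lam (app (wk v′) u′)) s′)
  vrapp⁺-step-tracked a b pv pu ps (left s) = ⊥-elim (value↛ a s)
  vrapp⁺-step-tracked {v′ = v′} a b pv pu ps (right _ s) = inner (app-step-inv s)
    where
    inner : ∀ {y} → AppStep (lam _) _ y → Tracks (app _ y) _
    inner (left s₁)    = ⊥-elim (value↛ (lam _) s₁)
    inner (right _ s₁) with step-tracked ps s₁
    ... | tracks r rel = tracks (→l*-appʳ (lam _) r) (vrapp⁺ a b pv pu rel)
    inner (beta vs) with value-tracked ps vs
    ... | w , r , vw , rel =
          tracks (→l*-appʳ (lam _) r ◅◅ (β→l-≡ vw (cong (λ X → app X _) (wk-[] v′ w)) ◅ ε))
                 (app pv (~-[] pu rel vs vw))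
  vrapp⁺-step-tracked a b pv pu ps (beta ())

  vrapp⁻-step-tracked : ∀ {v v′ u u′ s s′ x} → Value v → Value v′ → v ~ v′ → u ~ u′ → s ~ s′ →
    AppStep (lam (app (wk v) u)) s x → Tracks x (app v′ (app (lam u′) s′))
  vrapp⁻-step-tracked a b pv pu ps (left s) = ⊥-elim (value↛ (lam _) s)
  vrapp⁻-step-tracked a b pv pu ps (right _ s) with step-tracked ps s
  ... | tracks r rel = tracks (→l*-plugL (vapp _ b (vapp _ (lam _) hole)) r) (vrapp⁻ a b pv pu rel)
  vrapp⁻-step-tracked {v = v} a b pv pu ps (beta vs) with value-tracked ps vs
  ... | w , r , vw , rel =
        tracks (→l*-plugL (vapp _ b (vapp _ (lam _) hole)) r ◅◅ (→l-plugL (vapp _ b hole) (β→l vw) ◅ ε))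
               (~-respˡ-≡ (sym (cong (λ X → app X _) (wk-[] v _))) (app pv (~-[] pu rel vs vw)))

steps-tracked : ∀ {t t′ n} → t ~ t′ → t →l* n → Tracks n t′
steps-tracked p ε = tracks ε p
steps-tracked p (s ◅ ss) with step-tracked p s
... | tracks r rel with steps-tracked rel ss
...   | tracks r₂ rel₂ = tracks (r ◅◅ r₂) rel₂

-- Related normal forms satisfy the enf clauses

record MatchingDecomposition (t t′ : Tm) : Set where
  constructor decomposition
  field
    L L′    : LCtx
    x       : ℕ
    v v′    : Tm
    value   : Value v
    value′  : Value v′
    split   : t ≡ plugL L (app (var x) v)
    split′  : t′ ≡ plugL L′ (app (var x) v′)
    arg~    : v ~ v′
    context~ : ∀ {a a′} → a ~ a′ → plugL L a ~ plugL L′ a′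

decomposition-plugL : ∀ E E′ {s s′} → (∀ {a a′} → a ~ a′ → plugL E a ~ plugL E′ a′) →
                      MatchingDecomposition s s′ → MatchingDecomposition (plugL E s) (plugL E′ s′)
decomposition-plugL E E′ f (decomposition L L′ x v v′ vv vv′ eq eq′ rel lrel) =
  decomposition (E ∘L L) (E′ ∘L L′) x v v′ vv vv′
    (trans (cong (plugL E) eq) (sym (plugL-∘L E L _)))
    (trans (cong (plugL E′) eq′) (sym (plugL-∘L E′ L′ _)))
    rel
    (λ {a} {a′} p → ~-respˡ-≡ (sym (plugL-∘L E L a)) (~-respʳ-≡ (sym (plugL-∘L E′ L′ a′)) (f (lrel p))))

stuck-decomposition : ∀ {t t′} → t ~ t′ → Stuck t → Stuck t′ → MatchingDecomposition t t′
stuck-decomposition (app pt pu) (appˡ u st) (appˡ u′ st′) =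
  decomposition-plugL (lapp hole u) (lapp hole u′) (λ p → app p pu) (stuck-decomposition pt st st′)
stuck-decomposition (app pt pu) (appˡ _ st) (appʳ vt′ _)  = ⊥-elim (stuck≁value pt st vt′)
stuck-decomposition (app pt pu) (appˡ _ st) (var-app x _) = ⊥-elim (stuck≁value pt st (var x))
stuck-decomposition (app pt pu) (appʳ vt _) (appˡ _ st′)  = ⊥-elim (value≁stuck pt vt st′)
stuck-decomposition (app pt pu) (appʳ vt st) (appʳ vt′ st′) =
  decomposition-plugL (vapp _ vt hole) (vapp _ vt′ hole) (app pt) (stuck-decomposition pu st st′)
stuck-decomposition (app pt pu) (appʳ _ st) (var-app _ vu′) = ⊥-elim (stuck≁value pu st vu′)
stuck-decomposition (app pt pu) (var-app x _) (appˡ _ st′)  = ⊥-elim (value≁stuck pt (var x) st′)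
stuck-decomposition (app pt pu) (var-app _ vu) (appʳ _ st′) = ⊥-elim (value≁stuck pu vu st′)
stuck-decomposition (app pt pu) (var-app x vu) (var-app y vu′) with var~value pt (var y)
... | refl = decomposition hole hole x _ _ vu vu′ refl refl pu (λ p → p)
stuck-decomposition (id⁺ p) (appˡ _ ()) _
stuck-decomposition (id⁺ p) (appʳ _ st) st′ =
  decomposition-plugL (vapp I (lam _) hole) hole id⁺ (stuck-decomposition p st st′)
stuck-decomposition (id⁻ p) st (appˡ _ ())
stuck-decomposition (id⁻ p) st (appʳ _ st′) =
  decomposition-plugL hole (vapp I (lam _) hole) id⁻ (stuck-decomposition p st st′)
stuck-decomposition (assoc⁺ pt pu ps) st st′ =
  decomposition-plugL (vapp _ (lam _) (vapp _ (lam _) hole)) (vapp _ (lam _) hole) (assoc⁺ pt pu)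
    (stuck-decomposition ps (stuck-λ-arg (stuck-λ-arg st)) (stuck-λ-arg st′))
stuck-decomposition (assoc⁻ pt pu ps) st st′ =
  decomposition-plugL (vapp _ (lam _) hole) (vapp _ (lam _) (vapp _ (lam _) hole)) (assoc⁻ pt pu)
    (stuck-decomposition ps (stuck-λ-arg st) (stuck-λ-arg (stuck-λ-arg st′)))
stuck-decomposition (ldec⁺ pt pu) (appˡ _ st) st′ =
  decomposition-plugL (lapp hole _) (vapp _ (lam _) hole) (λ p → ldec⁺ p pu)
    (stuck-decomposition pt st (stuck-λ-arg st′))
stuck-decomposition (ldec⁺ pt pu) (appʳ vt _) st′    = ⊥-elim (value≁stuck pt vt (stuck-λ-arg st′))
stuck-decomposition (ldec⁺ pt pu) (var-app x _) st′  = ⊥-elim (value≁stuck pt (var x) (stuck-λ-arg st′))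
stuck-decomposition (ldec⁻ pt pu) st (appˡ _ st′) =
  decomposition-plugL (vapp _ (lam _) hole) (lapp hole _) (λ p → ldec⁻ p pu)
    (stuck-decomposition pt (stuck-λ-arg st) st′)
stuck-decomposition (ldec⁻ pt pu) st (appʳ vt′ _)    = ⊥-elim (stuck≁value pt (stuck-λ-arg st) vt′)
stuck-decomposition (ldec⁻ pt pu) st (var-app x _)   = ⊥-elim (stuck≁value pt (stuck-λ-arg st) (var x))
stuck-decomposition (rdec⁺ a b pv pt) (appˡ _ st) _  = ⊥-elim (value-¬stuck a st)
stuck-decomposition (rdec⁺ a b pv pt) (appʳ _ st) st′ =
  decomposition-plugL (vapp _ a hole) (vapp _ (lam _) hole) (rdec⁺ a b pv)
    (stuck-decomposition pt st (stuck-λ-arg st′))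
stuck-decomposition (rdec⁺ a b pv pt) (var-app x vt) st′ = ⊥-elim (value≁stuck pt vt (stuck-λ-arg st′))
stuck-decomposition (rdec⁻ a b pv pt) st (appˡ _ st′)  = ⊥-elim (value-¬stuck b st′)
stuck-decomposition (rdec⁻ a b pv pt) st (appʳ _ st′) =
  decomposition-plugL (vapp _ (lam _) hole) (vapp _ b hole) (rdec⁻ a b pv)
    (stuck-decomposition pt (stuck-λ-arg st) st′)
stuck-decomposition (rdec⁻ a b pv pt) st (var-app x vt′) = ⊥-elim (stuck≁value pt (stuck-λ-arg st) vt′)
stuck-decomposition (lapp⁺ pt pu ps) (appˡ _ st) st′ =
  decomposition-plugL (lapp (vapp _ (lam _) hole) _) (vapp _ (lam _) hole) (λ p → lapp⁺ pt p ps)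
    (stuck-decomposition pu (stuck-λ-arg st) (stuck-λ-arg st′))
stuck-decomposition (lapp⁺ pt pu ps) (appʳ () _) _
stuck-decomposition (lapp⁻ pt pu ps) st (appˡ _ st′) =
  decomposition-plugL (vapp _ (lam _) hole) (lapp (vapp _ (lam _) hole) _) (λ p → lapp⁻ pt p ps)
    (stuck-decomposition pu (stuck-λ-arg st) (stuck-λ-arg st′))
stuck-decomposition (lapp⁻ pt pu ps) st (appʳ () _)
stuck-decomposition (vrapp⁺ a b pv pu ps) (appˡ _ st) _ = ⊥-elim (value-¬stuck a st)
stuck-decomposition (vrapp⁺ a b pv pu ps) (appʳ _ st) st′ =
  decomposition-plugL (vapp _ a (vapp _ (lam _) hole)) (vapp _ (lam _) hole) (vrapp⁺ a b pv pu)
    (stuck-decomposition ps (stuck-λ-arg st) (stuck-λ-arg st′))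
stuck-decomposition (vrapp⁻ a b pv pu ps) st (appˡ _ st′) = ⊥-elim (value-¬stuck b st′)
stuck-decomposition (vrapp⁻ a b pv pu ps) st (appʳ _ st′) =
  decomposition-plugL (vapp _ (lam _) hole) (vapp _ b (vapp _ (lam _) hole)) (vrapp⁻ a b pv pu)
    (stuck-decomposition ps (stuck-λ-arg st) (stuck-λ-arg st′))

-- Binders are ignored, so this bounds the free indices of the term at every depth.
var-bound : Tm → ℕ
var-bound (var x)   = suc x
var-bound (lam t)   = var-bound t
var-bound (app t u) = var-bound t + var-bound u

occurs-<-var-bound : ∀ {x} t → Occurs x t → x < var-bound t
occurs-<-var-bound (var y)   refl     = ≤-refl
occurs-<-var-bound (lam t)   o        = ≤-trans (n≤1+n _) (occurs-<-var-bound t o)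
occurs-<-var-bound (app t u) (inj₁ o) = ≤-trans (occurs-<-var-bound t o) (m≤m+n _ _)
occurs-<-var-bound (app t u) (inj₂ o) = ≤-trans (occurs-<-var-bound u o) (m≤n+m _ _)

var-boundL : LCtx → ℕ
var-boundL hole         = 0
var-boundL (vapp v _ L) = var-bound v + var-boundL L
var-boundL (lapp L t)   = var-boundL L + var-bound t

occursL-<-var-boundL : ∀ {x} L → OccursL x L → x < var-boundL L
occursL-<-var-boundL (vapp v _ L) (inj₁ o) = ≤-trans (occurs-<-var-bound v o) (m≤m+n _ _)
occursL-<-var-boundL (vapp v _ L) (inj₂ o) = ≤-trans (occursL-<-var-boundL L o) (m≤n+m _ _)
occursL-<-var-boundL (lapp L t)   (inj₁ o) = ≤-trans (occursL-<-var-boundL L o) (m≤m+n _ _)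
occursL-<-var-boundL (lapp L t)   (inj₂ o) = ≤-trans (occurs-<-var-bound t o) (m≤n+m _ _)

fresh-for-both : ∀ L L′ → ¬ OccursL (var-boundL L + var-boundL L′) L × ¬ OccursL (var-boundL L + var-boundL L′) L′
fresh-for-both L L′ =
  (λ o → ≤⇒≯ (m≤m+n (var-boundL L) (var-boundL L′)) (occursL-<-var-boundL L o)) ,
  (λ o → ≤⇒≯ (m≤n+m (var-boundL L′) (var-boundL L)) (occursL-<-var-boundL L′ o))

nf-clause : ∀ {n n′ t′} → Nf n → Nf n′ → n ~ n′ → t′ →l* n′ → SimClause _~_ n t′
nf-clause (inj₁ (var x)) (inj₁ vn′) p red with var~value p vn′
... | refl = inj₁ (x , refl , red , Nf⇒Normal (inj₁ vn′))
nf-clause (inj₁ (lam b)) (inj₁ vn′) p red with lam~value p vn′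
... | b′ , refl , rb = inj₂ (inj₁ (b , refl , b′ , (red , Nf⇒Normal (inj₁ vn′)) , rb))
nf-clause (inj₁ vn) (inj₂ st′) p red = ⊥-elim (value≁stuck p vn st′)
nf-clause (inj₂ st) (inj₁ vn′) p red = ⊥-elim (stuck≁value p st vn′)
nf-clause (inj₂ st) (inj₂ st′) p red with stuck-decomposition p st st′
... | decomposition L L′ x v v′ vv vv′ eq refl rel lrel with fresh-for-both L L′
...   | fresh , fresh′ =
        inj₂ (inj₂ (L , x , v , vv , eq , L′ , v′ , vv′ , (red , Nf⇒Normal (inj₂ st′)) , rel ,
                    _ , fresh , fresh′ , lrel (var _)))

~-enfSim : EnfSim _~_
~-enfSim t t′ p n (r , normal) with steps-tracked p r
... | tracks r₁ rel₁ with nf-tracked rel₁ (Normal⇒Nf normal)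
...   | tracksNf r₂ nf₂ rel₂ = nf-clause (Normal⇒Nf normal) nf₂ rel₂ (r₁ ◅◅ r₂)

SimClause-map : ∀ {R S : Tm → Tm → Set} → (∀ {a b} → R a b → S a b) → ∀ {n t′} → SimClause R n t′ → SimClause S n t′
SimClause-map f (inj₁ c) = inj₁ c
SimClause-map f (inj₂ (inj₁ (b , e , b′ , d , rb))) = inj₂ (inj₁ (b , e , b′ , d , f rb))
SimClause-map f (inj₂ (inj₂ (L , x , v , vv , e , L′ , v′ , vv′ , d , rel , z , f₁ , f₂ , lr))) =
  inj₂ (inj₂ (L , x , v , vv , e , L′ , v′ , vv′ , d , f rel , z , f₁ , f₂ , f lr))

~-converse-enfSim : EnfSim (Converse _~_)
~-converse-enfSim t t′ p n h = SimClause-map ~-sym (~-enfSim t t′ (~-sym p) n h)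

~⇒≃enf : ∀ {t u} → t ~ u → t ≃enf u
~⇒≃enf p = _~_ , p , ~-enfSim , ~-converse-enfSim

validates-⊆~ : ∀ {A : Tm → Tm → Set} → (∀ {l r} → A l r → l ~ r) → Validates A
validates-⊆~ A⊆~ t u (cl C a) = ~⇒≃enf (~-plug C (A⊆~ a))

-- The invalid equivalences

loop-→l* : ∀ {a b} → a →l a → a →l* b → b ≡ a
loop-→l* l ε = refl
loop-→l* l (s ◅ ss) with →l-deterministic s l
... | refl = loop-→l* l ss

loop⇒¬⇓ : ∀ {a} → a →l a → ∀ n → ¬ (a ⇓ n)
loop⇒¬⇓ l n (r , normal) with loop-→l* l r
... | refl = normal (_ , l)

normal-≄enf-diverging : ∀ {t t′} → Normal t → (∀ n → ¬ (t′ ⇓ n)) → ¬ (t ≃enf t′)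
normal-≄enf-diverging nt div (R , r , sim , _) with sim _ _ r _ (ε , nt)
... | inj₁ (_ , _ , d)                                 = div _ d
... | inj₂ (inj₁ (_ , _ , _ , d , _))                  = div _ d
... | inj₂ (inj₂ (_ , _ , _ , _ , _ , _ , _ , _ , d , _)) = div _ d

Ω : Tm
Ω = app ω ω
  where
  ω : Tm
  ω = lam (app (var zero) (var zero))

λ-Ω-loop : ∀ b → app (lam b) Ω →l app (lam b) Ω
λ-Ω-loop b = →l-plugL (vapp (lam b) (lam b) hole) (β→l (lam _))

¬validates-rightApp : NotValidates RightApp
¬validates-rightApp =
  _ , _ , cl hole (ax (app (var 0) (var 1)) (var 0) Ω) ,
  normal-≄enf-diverging (Nf⇒Normal (inj₂ (appˡ _ (var-app 0 (var 1))))) (loop⇒¬⇓ (λ-Ω-loop _))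

¬validates-comm : NotValidates Comm
¬validates-comm =
  _ , _ , cl hole (ax (var 0) Ω (app (var 0) (var 1))) ,
  normal-≄enf-diverging (Nf⇒Normal (inj₂ (appʳ (lam _) (var-app 0 (var 1))))) (loop⇒¬⇓ (λ-Ω-loop _))

¬validates-etaV : NotValidates EtaV
¬validates-etaV = _ , _ , cl hole (ax 0) , λ (R , r , sim , _) → ¬clause R (sim _ _ r _ (ε , Nf⇒Normal (inj₁ (var 0))))
  where
  ¬clause : ∀ R → ¬ SimClause R (var 0) (lam (app (var 1) (var 0)))
  ¬clause R (inj₁ (_ , refl , red , _)) with Normal-→l* (Nf⇒Normal (inj₁ (lam _))) red
  ... | ()
  ¬clause R (inj₂ (inj₁ (_ , () , _)))
  ¬clause R (inj₂ (inj₂ (L , _ , _ , _ , e , _))) = value≢plugL-app (var 0) L e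

plugL-var-app-unique : ∀ L L₂ {x x₂ v v₂} → Value v → Value v₂ →
  plugL L (app (var x) v) ≡ plugL L₂ (app (var x₂) v₂) → x ≡ x₂ × (∀ a → plugL L a ≡ plugL L₂ a)
plugL-var-app-unique hole hole _ _ refl = refl , λ _ → refl
plugL-var-app-unique hole (vapp _ _ L₂) vv _ e = ⊥-elim (value≢plugL-app vv L₂ (proj₂ (app-injective e)))
plugL-var-app-unique hole (lapp L₂ _) _ _ e = ⊥-elim (value≢plugL-app (var _) L₂ (proj₁ (app-injective e)))
plugL-var-app-unique (vapp _ _ L) hole _ vv₂ e = ⊥-elim (value≢plugL-app vv₂ L (sym (proj₂ (app-injective e))))
plugL-var-app-unique (lapp L _) hole _ _ e = ⊥-elim (value≢plugL-app (var _) L (sym (proj₁ (app-injective e))))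
plugL-var-app-unique (vapp _ _ L) (vapp _ _ L₂) vv vv₂ e
  with app-injective e
... | w≡w₂ , e′ with plugL-var-app-unique L L₂ vv vv₂ e′
...   | x≡x₂ , same = x≡x₂ , λ a → cong₂ app w≡w₂ (same a)
plugL-var-app-unique (vapp _ vw _) (lapp L₂ _) _ _ e = ⊥-elim (value≢plugL-app vw L₂ (proj₁ (app-injective e)))
plugL-var-app-unique (lapp L _) (vapp _ vw₂ _) _ _ e = ⊥-elim (value≢plugL-app vw₂ L (sym (proj₁ (app-injective e))))
plugL-var-app-unique (lapp L _) (lapp L₂ _) vv vv₂ e
  with app-injective e
... | e′ , t≡t₂ with plugL-var-app-unique L L₂ vv vv₂ e′
...   | x≡x₂ , same = x≡x₂ , λ a → cong₂ app (same a) t≡t₂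

occurs-plugL : ∀ L {x a} → Occurs x (plugL L a) → OccursL x L ⊎ Occurs x a
occurs-plugL hole         o        = inj₂ o
occurs-plugL (vapp v _ L) (inj₁ o) = inj₁ (inj₁ o)
occurs-plugL (vapp v _ L) (inj₂ o) with occurs-plugL L o
... | inj₁ p = inj₁ (inj₂ p)
... | inj₂ p = inj₂ p
occurs-plugL (lapp L t)   (inj₁ o) with occurs-plugL L o
... | inj₁ p = inj₁ (inj₁ p)
... | inj₂ p = inj₂ p
occurs-plugL (lapp L t)   (inj₂ o) = inj₁ (inj₂ o)

occursL⇒occurs-plugL : ∀ L {x} a → OccursL x L → Occurs x (plugL L a)
occursL⇒occurs-plugL (vapp v _ L) a (inj₁ o) = inj₁ o
occursL⇒occurs-plugL (vapp v _ L) a (inj₂ o) = inj₂ (occursL⇒occurs-plugL L a o)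
occursL⇒occurs-plugL (lapp L t)   a (inj₁ o) = inj₁ (occursL⇒occurs-plugL L a o)
occursL⇒occurs-plugL (lapp L t)   a (inj₂ o) = inj₂ o

-- Plugging the closed term I separates the occurrences in the context from those in the hole.
occursL-resp-plugL : ∀ {L L₂ x} → (∀ a → plugL L a ≡ plugL L₂ a) → OccursL x L → OccursL x L₂
occursL-resp-plugL {L} {L₂} same o with occurs-plugL L₂ (≡.subst (Occurs _) (same I) (occursL⇒occurs-plugL L I o))
... | inj₁ o₂ = o₂
... | inj₂ ()

stuck-clause : ∀ {R} L {x v} L′ {x′ v′} → Value v → Value v′ → Normal (plugL L′ (app (var x′) v′)) →
  SimClause R (plugL L (app (var x) v)) (plugL L′ (app (var x′) v′)) →
  x ≡ x′ × ∃[ z ] (¬ OccursL z L′ × R (plugL L (var z)) (plugL L′ (var z)))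
stuck-clause L L′ _ _ _ (inj₁ (_ , e , _)) = ⊥-elim (value≢plugL-app (var _) L (sym e))
stuck-clause L L′ _ _ _ (inj₂ (inj₁ (_ , e , _))) = ⊥-elim (value≢plugL-app (lam _) L (sym e))
stuck-clause {R} L L′ vv vv′ normal
  (inj₂ (inj₂ (L₃ , _ , _ , vv₃ , e , L₃′ , _ , vv₃′ , (red , _) , _ , z , _ , fresh′ , rz)))
  with plugL-var-app-unique L L₃ vv vv₃ e | plugL-var-app-unique L′ L₃′ vv′ vv₃′ (Normal-→l* normal red)
... | refl , same | refl , same′ =
  refl , z , fresh′ ∘ occursL-resp-plugL same′ , subst₂ R (sym (same (var z))) (sym (same′ (var z))) rz

-- With y := 0 and u := x₁ x₂ both sides are stuck on u. Plugging a fresh z for it, the left side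
-- steps to 0 z z while the right side 0 z u is stuck on 0 z, so some z₂ fresh for ⟨·⟩ u relates
-- z₂ z to z₂ u; the latter is stuck on x₁ x₂, which forces z₂ = 1.
¬validates-cbnDup : NotValidates CbNDup
¬validates-cbnDup = _ , _ , cl hole (ax 0 u) , λ (R , r , sim , _) → ¬related R sim r
  where
  u : Tm
  u = app (var 1) (var 2)

  ¬related : ∀ R → EnfSim R → ¬ R (app (lam (app (app (var 1) (var 0)) (var 0))) u) (app (app (var 0) u) u)
  ¬related R sim r
    with stuck-clause (vapp _ (lam _) hole) (lapp (vapp (var 0) (var 0) hole) u) (var 2) (var 2)
           (Nf⇒Normal (inj₂ (appˡ _ (appʳ (var 0) (var-app 1 (var 2))))))
           (sim _ _ r _ (ε , Nf⇒Normal (inj₂ (appʳ (lam _) (var-app 1 (var 2))))))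
  ... | _ , z , _ , r₁
    with stuck-clause (lapp hole (var z)) (lapp hole u) (var z) (var z)
           (Nf⇒Normal (inj₂ (appˡ _ (var-app 0 (var z)))))
           (sim _ _ r₁ _ (β→l (var z) ◅ ε , Nf⇒Normal (inj₂ (appˡ _ (var-app 0 (var z))))))
  ... | _ , z₂ , fresh , r₂
    with stuck-clause hole (vapp (var z₂) (var z₂) hole) (var z) (var 2)
           (Nf⇒Normal (inj₂ (appʳ (var z₂) (var-app 1 (var 2)))))
           (sim _ _ r₂ _ (ε , Nf⇒Normal (inj₂ (var-app z₂ (var z)))))
  ... | refl , _ = fresh (inj₂ (inj₁ refl))

proposition8p7 : (Validates LeftId × Validates Assoc × Validates LeftDec ×
                   Validates RightDec × Validates LeftApp × Validates ValRightApp)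
                 × (NotValidates EtaV × NotValidates RightApp ×
                    NotValidates Comm × NotValidates CbNDup)
proposition8p7 =
  ( validates-⊆~ (λ { (ax t) → id⁺ (~-refl t) })
  , validates-⊆~ (λ { (ax t u s) → assoc⁺ (~-refl t) (~-refl u) (~-refl s) })
  , validates-⊆~ (λ { (ax t u) → ldec⁺ (~-refl t) (~-refl u) })
  , validates-⊆~ (λ { (ax v t vv) → rdec⁺ vv vv (~-refl v) (~-refl t) })
  , validates-⊆~ (λ { (ax t u s) → lapp⁺ (~-refl t) (~-refl u) (~-refl s) })
  , validates-⊆~ (λ { (ax v u s vv) → vrapp⁺ vv vv (~-refl v) (~-refl u) (~-refl s) })
  )
  , (¬validates-etaV , ¬validates-rightApp , ¬validates-comm , ¬validates-cbnDup)
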